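{- Let $\lambda$ be a partition with $\ell=\ell(\lambda)$ and $\phi=(\phi_1\le\dots\le\phi_\ell)$ a flag compatible with $\lambda$ with only non-negative entries. Let $\psi_i=\min(i-\lambda_i,\phi_i)$ and $\Delta_i=\phi_i-\psi_i$ for $1\le i\le\ell$. Then $\Delta=(\Delta_1,\dots,\Delta_\ell)$ is a weakly decreasing sequence of non-negative integers.
   Context: A flag for $\lambda$ is a weakly increasing sequence of integers of length $\ell(\lambda)$; it is compatible with $\lambda$ if $\phi_{i+1}-\phi_i\le\lambda_i-\lambda_{i+1}+1$ for $1\le i<\ell(\lambda)$. -}

module Defs where

open import Data.Nat using (ℕ; suc)
open import Data.Fin using (Fin; toℕ; inject₁) renaming (suc to fsuc; _≤_ to _≤ᶠ_)
open import Data.Unit using (⊤)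
open import Data.Integer as ℤ using (ℤ; +_; _-_; _⊓_)

-- A partition of length ℓ: parts λ₁ ≥ λ₂ ≥ … ≥ λ_ℓ ≥ 1 (indexed by Fin ℓ,
-- index i : Fin ℓ corresponds to the paper's index toℕ i + 1).
record Partition (ℓ : ℕ) : Set where
  field
    part     : Fin ℓ → ℕ
    positive : ∀ i → 1 Data.Nat.≤ part i
    decr     : ∀ i j → i ≤ᶠ j → part j Data.Nat.≤ part i
open Partition public

IsFlag : {ℓ : ℕ} → (Fin ℓ → ℤ) → Set
IsFlag {ℓ} φ = ∀ i j → i ≤ᶠ j → φ i ℤ.≤ φ j

Compatible : {ℓ : ℕ} → Partition ℓ → (Fin ℓ → ℤ) → Set
Compatible {ℕ.zero} lam φ = ⊤
Compatible {suc n} lam φ =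
  ∀ (i : Fin n) →
    φ (fsuc i) - φ (inject₁ i)
      ℤ.≤ (+ part lam (inject₁ i) - + part lam (fsuc i)) ℤ.+ + 1

-- ψ_i = min(i - λ_i, φ_i), with the paper's 1-based index i = toℕ i + 1.
ψ : {ℓ : ℕ} → Partition ℓ → (Fin ℓ → ℤ) → Fin ℓ → ℤ
ψ lam φ i = (+ suc (toℕ i) - + part lam i) ⊓ φ i

Δ : {ℓ : ℕ} → Partition ℓ → (Fin ℓ → ℤ) → Fin ℓ → ℤ
Δ lam φ i = φ i - ψ lam φ i

-- Δᵢ = φᵢ - min(i - λᵢ, φᵢ) = max(0, φᵢ - (i - λᵢ)), and compatibility says precisely that
-- the excess φᵢ - (i - λᵢ) is weakly decreasing in i; truncating at 0 preserves this.
module Submission where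

open import Defs
open import Data.Nat using (ℕ; suc; z≤n; s≤s)
open import Data.Fin using (Fin; toℕ; inject₁) renaming (_≤_ to _≤ᶠ_; zero to fzero; suc to fsuc)
open import Data.Fin.Properties using (toℕ-inject₁)
open import Data.Integer using (ℤ; +_; 0ℤ; _+_; _-_; _≤_; _⊓_; _⊔_)
open import Data.Integer.Properties
open import Data.Integer.Solver using (module +-*-Solver)
open import Data.Product using (_×_; _,_)
open import Relation.Binary.Bundles using (Preorder)
open import Relation.Binary.PropositionalEquality using (_≡_; refl; sym; trans; cong; subst; subst₂)

steps⇒antitone : ∀ {c ℓ₁ ℓ₂} (P : Preorder c ℓ₁ ℓ₂) {n : ℕ} (f : Fin (suc n) → Preorder.Carrier P) →
  (∀ k → Preorder._≲_ P (f (fsuc k)) (f (inject₁ k))) →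
  ∀ i j → i ≤ᶠ j → Preorder._≲_ P (f j) (f i)
steps⇒antitone P f step fzero fzero _ = Preorder.refl P
steps⇒antitone P {suc n} f step fzero (fsuc j) _ =
  Preorder.trans P (steps⇒antitone P (λ x → f (fsuc x)) (λ k → step (fsuc k)) fzero j z≤n) (step fzero)
steps⇒antitone P {suc n} f step (fsuc i) (fsuc j) (s≤s i≤j) =
  steps⇒antitone P (λ x → f (fsuc x)) (λ k → step (fsuc k)) i j i≤j

sub-⊓-self : ∀ x c → x - (c ⊓ x) ≡ (x - c) ⊔ 0ℤ
sub-⊓-self x c = trans (antimono-≤-distrib-⊓ (λ p → +-monoʳ-≤ x (neg-mono-≤ p)) c x)
                       (cong ((x - c) ⊔_) (+-inverseʳ x))

shift-≤ : ∀ q p K y x → q - p ≤ (x - y) + + 1 → q - ((+ 1 + K) - y) ≤ p - (K - x)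
shift-≤ q p K y x compat = begin
  q - ((+ 1 + K) - y)               ≡⟨ lhs q p K y ⟩
  (q - p) + r                       ≤⟨ +-monoˡ-≤ r compat ⟩
  ((x - y) + + 1) + r               ≡⟨ rhs p K y x ⟩
  p - (K - x)                       ∎
  where
  open ≤-Reasoning
  open +-*-Solver
  r = p - ((+ 1 + K) - y)
  lhs : ∀ q p K y → q - ((+ 1 + K) - y) ≡ (q - p) + (p - ((+ 1 + K) - y))
  lhs = solve 4 (λ q p K y → q :- ((con (+ 1) :+ K) :- y) := (q :- p) :+ (p :- ((con (+ 1) :+ K) :- y))) refl
  rhs : ∀ p K y x → ((x - y) + + 1) + (p - ((+ 1 + K) - y)) ≡ p - (K - x)
  rhs = solve 4 (λ p K y x → ((x :- y) :+ con (+ 1)) :+ (p :- ((con (+ 1) :+ K) :- y)) := p :- (K :- x)) refl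

excess : ∀ {ℓ} → Partition ℓ → (Fin ℓ → ℤ) → Fin ℓ → ℤ
excess lam φ i = φ i - (+ suc (toℕ i) - + part lam i)

Δ≡excess⊔0 : ∀ {ℓ} (lam : Partition ℓ) φ i → Δ lam φ i ≡ excess lam φ i ⊔ 0ℤ
Δ≡excess⊔0 lam φ i = sub-⊓-self (φ i) (+ suc (toℕ i) - + part lam i)

compatible⇒excess-step : ∀ {n} (lam : Partition (suc n)) φ → Compatible lam φ →
  ∀ k → excess lam φ (fsuc k) ≤ excess lam φ (inject₁ k)
compatible⇒excess-step lam φ compat k =
  subst (λ m → excess lam φ (fsuc k) ≤ φ (inject₁ k) - (+ suc m - + part lam (inject₁ k)))
        (sym (toℕ-inject₁ k))
        (shift-≤ (φ (fsuc k)) (φ (inject₁ k)) (+ suc (toℕ k))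
                 (+ part lam (fsuc k)) (+ part lam (inject₁ k)) (compat k))

compatible⇒excess-antitone : ∀ {ℓ} (lam : Partition ℓ) φ → Compatible lam φ →
  ∀ i j → i ≤ᶠ j → excess lam φ j ≤ excess lam φ i
compatible⇒excess-antitone {suc n} lam φ compat =
  steps⇒antitone ≤-preorder (excess lam φ) (compatible⇒excess-step lam φ compat)

lemma3p11 : (ℓ : ℕ) (lam : Partition ℓ) (φ : Fin ℓ → ℤ) →
    IsFlag φ → Compatible lam φ → (∀ i → + 0 ≤ φ i) →
    (∀ i → + 0 ≤ Δ lam φ i) × (∀ i j → i ≤ᶠ j → Δ lam φ j ≤ Δ lam φ i)
lemma3p11 ℓ lam φ _ compat _ = Δ-nonneg , Δ-antitone
  where
  Δ-nonneg : ∀ i → + 0 ≤ Δ lam φ i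
  Δ-nonneg i = subst (0ℤ ≤_) (sym (Δ≡excess⊔0 lam φ i)) (i≤j⊔i (excess lam φ i) 0ℤ)

  Δ-antitone : ∀ i j → i ≤ᶠ j → Δ lam φ j ≤ Δ lam φ i
  Δ-antitone i j i≤j =
    subst₂ _≤_ (sym (Δ≡excess⊔0 lam φ j)) (sym (Δ≡excess⊔0 lam φ i))
           (⊔-monoˡ-≤ 0ℤ (compatible⇒excess-antitone lam φ compat i j i≤j))
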